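{- Let $x=(x_i)_{i\in\mathbb{Z}}\in\mathbb{Z}\mathsf{J}_{\infty,\infty}$ have degree $d\geqslant 1$, suppose all its entries are non-negative, $q(x)>0$, and $x=\mathrm{dec}(x)$ (i.e. $x_i\geqslant x_{i+1}$ for all $i$). Then $x$ is (the image of) a root lattice element of the natural $\mathsf{J}_{2d-1,4d-2}$ subsystem, i.e. $x_i=d$ for all $i\leqslant -2d$ and $x_i=0$ for all $i\geqslant 2d-1$.
   Context: $\mathbb{Z}\mathsf{J}_{\infty,\infty}$ is the set of integer sequences $(x_i)_{i\in\mathbb{Z}}$ for which there exist $M\in\mathbb{N}$ and an integer $d$ with $x_{ -M}+\cdots+x_M=Md$, $x_i=0$ for $i>M$ and $x_i=d$ for $i<-M$; $d$ (independent of the choice of $M$) is the degree of $x$, and $q(x)=\sum_{i=-M}^{M}x_i^2+(2-M)d^2$ (also independent of $M$). For $1\leqslant k<n$, an element $y=(y_1,\ldots,y_n)$ of the root lattice $\{y\in\mathbb{Z}^n: k\mid \sum y_j\}$ of $\mathsf{J}_{k,n}$ of degree $d=\sum y_j/k$ is identified with the sequence $x$ given by $x_{j-k-1}=y_j$ for $1\leqslant j\leqslant n$, $x_i=d$ for $i<-k$, and $x_i=0$ for $i\geqslant n-k$ (this is the iteration of the embeddings $(y_1,\ldots,y_n)\mapsto(y_1,\ldots,y_n,0)$ into $\mathsf{J}_{k,n+1}$ and $(y_1,\ldots,y_n)\mapsto(d,y_1,\ldots,y_n)$ into $\mathsf{J}_{k+1,n+1}$). $\mathrm{dec}(x)$ denotes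 the rearrangement of the entries into weakly decreasing order. -}

module Defs where

open import Data.Nat using (ℕ; zero; suc)
open import Data.Integer using (ℤ; +_; _+_; _*_; _-_; -_; _<_; _>_)
open import Data.Product using (_×_)
open import Relation.Binary.PropositionalEquality using (_≡_)

sumFrom : (ℤ → ℤ) → ℤ → ℕ → ℤ
sumFrom f a zero    = + 0
sumFrom f a (suc n) = f a + sumFrom f (a + + 1) n

sumSym : (ℤ → ℤ) → ℕ → ℤ
sumSym f M = sumFrom f (- (+ M)) (suc (M Data.Nat.+ M))

-- x ∈ ℤJ_{∞,∞} with degree d, witnessed by M:
-- x_{-M}+...+x_M = M d, x_i = 0 for i > M, x_i = d for i < -M.
IsZJ : (ℤ → ℤ) → ℕ → ℤ → Set
IsZJ x M d =
  (sumSym x M ≡ (+ M) * d)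
  × (∀ i → i > + M → x i ≡ + 0)
  × (∀ i → i < - (+ M) → x i ≡ d)

q : (ℤ → ℤ) → ℕ → ℤ → ℤ
q x M d = sumSym (λ i → x i * x i) M + (+ 2 - + M) * (d * d)

-- Splitting the window [-M, M] at 0 and using x_{-M} + ... + x_M = M d, for every integer s
--   2d² - q(x) = Σ_{-M ≤ i < 0} (x_i - s)(d - x_i) + Σ_{0 ≤ i ≤ M} x_i (s + d - x_i).
-- As x is decreasing with values in [0, d], if x_{2d-1} ≥ 1 then with s = 1 every term is
-- non-negative and the 2d terms with 0 ≤ i < 2d are at least d, so q(x) ≤ 0.  Symmetrically,
-- if x_{-2d} < d then with s = -1 the 2d terms with -2d ≤ i < 0 are at least d.

module Submission where

open import Defs
open import Data.Nat using (ℕ)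
open import Data.Integer using (ℤ; +_; _+_; _*_; _-_; -_; _≤_; _<_; _>_; _≥_)
open import Data.Product using (_×_)
open import Relation.Binary.PropositionalEquality using (_≡_)

open import Data.Integer.Base using (0ℤ; 1ℤ; -1ℤ; -[1+_]; +≤+; -≤+; +<+; ∣_∣; nonNegative)
open import Data.Integer.Properties
  using ( +-identityˡ; +-comm; +-identityʳ; +-assoc; +-inverseˡ; *-zeroʳ; suc-*; pos-+
        ; ≤-refl; ≤-reflexive; ≤-trans; ≤-antisym; ≤-<-trans; <-irrefl; ≮⇒≥
        ; +-mono-≤; +-monoˡ-≤; +-mono-<-≤; *-monoʳ-≤-nonNeg
        ; i≤i+j; i≤j⇒0≤j-i; i≤j⇒i-j≤0; i≤j⇒i≤1+j; i<j⇒suc[i]≤j; i<j⇒i≤pred[j]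
        ; i⊓j≤i; i⊓j≤j; neg-mono-<; 0≤i⇒+∣i∣≡i; <⇒≱; module ≤-Reasoning )
open import Data.Integer.Tactic.RingSolver using (solve-∀)
import Data.Nat as ℕ
import Data.Nat.Properties as ℕ
open import Data.Product using (_,_; proj₁; proj₂)
open import Relation.Binary.PropositionalEquality
  using (_≗_; refl; sym; trans; cong; cong₂; subst; module ≡-Reasoning)
open import Relation.Nullary using (¬_; yes; no)

sumFrom-++ : ∀ f a m n → sumFrom f a (m ℕ.+ n) ≡ sumFrom f a m + sumFrom f (a + + m) n
sumFrom-++ f a ℕ.zero    n = sym (trans (+-identityˡ _) (cong (λ b → sumFrom f b n) (+-identityʳ a)))
sumFrom-++ f a (ℕ.suc m) n = begin
  f a + sumFrom f (a + 1ℤ) (m ℕ.+ n)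
    ≡⟨ cong (λ s → f a + s) (sumFrom-++ f (a + 1ℤ) m n) ⟩
  f a + (sumFrom f (a + 1ℤ) m + sumFrom f (a + 1ℤ + + m) n)
    ≡⟨ sym (+-assoc (f a) _ _) ⟩
  f a + sumFrom f (a + 1ℤ) m + sumFrom f (a + 1ℤ + + m) n
    ≡⟨ cong (λ b → f a + sumFrom f (a + 1ℤ) m + sumFrom f b n) (+-assoc a 1ℤ (+ m)) ⟩
  f a + sumFrom f (a + 1ℤ) m + sumFrom f (a + + ℕ.suc m) n
    ∎
  where open ≡-Reasoning

sumSym-split : ∀ f M → sumSym f M ≡ sumFrom f (- + M) M + sumFrom f 0ℤ (ℕ.suc M)
sumSym-split f M = begin
  sumFrom f (- + M) (ℕ.suc (M ℕ.+ M))
    ≡⟨ cong (sumFrom f (- + M)) (sym (ℕ.+-suc M M)) ⟩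
  sumFrom f (- + M) (M ℕ.+ ℕ.suc M)
    ≡⟨ sumFrom-++ f (- + M) M (ℕ.suc M) ⟩
  sumFrom f (- + M) M + sumFrom f (- + M + + M) (ℕ.suc M)
    ≡⟨ cong (λ b → sumFrom f (- + M) M + sumFrom f b (ℕ.suc M)) (+-inverseˡ (+ M)) ⟩
  sumFrom f (- + M) M + sumFrom f 0ℤ (ℕ.suc M)
    ∎
  where open ≡-Reasoning

sumFrom-cong : ∀ {f g} → f ≗ g → ∀ a n → sumFrom f a n ≡ sumFrom g a n
sumFrom-cong f≗g a ℕ.zero    = refl
sumFrom-cong f≗g a (ℕ.suc n) = cong₂ _+_ (f≗g a) (sumFrom-cong f≗g (a + 1ℤ) n)

sumFrom-quadratic : ∀ (x : ℤ → ℤ) b c e a n →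
  sumFrom (λ i → b * x i + c * (x i * x i) + e) a n
    ≡ b * sumFrom x a n + c * sumFrom (λ i → x i * x i) a n + + n * e
sumFrom-quadratic x b c e a ℕ.zero    = empty b c e
  where
  empty : ∀ b c e → 0ℤ ≡ b * 0ℤ + c * 0ℤ + 0ℤ * e
  empty = solve-∀
sumFrom-quadratic x b c e a (ℕ.suc n) =
  trans (cong (λ s → b * x a + c * (x a * x a) + e + s) (sumFrom-quadratic x b c e (a + 1ℤ) n))
        (step b c e (x a) (sumFrom x (a + 1ℤ) n) (sumFrom (λ i → x i * x i) (a + 1ℤ) n) (+ n))
  where
  step : ∀ b c e y X Q N →
    b * y + c * (y * y) + e + (b * X + c * Q + N * e) ≡ b * (y + X) + c * (y * y + Q) + (1ℤ + N) * e
  step = solve-∀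

sumFrom-≥ : ∀ f a n {c} → (∀ j → j ℕ.< n → c ≤ f (a + + j)) → + n * c ≤ sumFrom f a n
sumFrom-≥ f a ℕ.zero    _   = ≤-refl
sumFrom-≥ f a (ℕ.suc n) {c} c≤f = begin
  + ℕ.suc n * c                   ≡⟨ suc-* (+ n) c ⟩
  c + + n * c                     ≤⟨ +-mono-≤ c≤fa (sumFrom-≥ f (a + 1ℤ) n c≤f′) ⟩
  f a + sumFrom f (a + 1ℤ) n      ∎
  where
  open ≤-Reasoning
  c≤fa : c ≤ f a
  c≤fa = subst (λ i → c ≤ f i) (+-identityʳ a) (c≤f 0 (ℕ.s≤s ℕ.z≤n))
  c≤f′ : ∀ j → j ℕ.< n → c ≤ f (a + 1ℤ + + j)
  c≤f′ j j<n = subst (λ i → c ≤ f i) (sym (+-assoc a 1ℤ (+ j))) (c≤f (ℕ.suc j) (ℕ.s≤s j<n))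

sumFrom-nonneg : ∀ f a n → (∀ j → j ℕ.< n → 0ℤ ≤ f (a + + j)) → 0ℤ ≤ sumFrom f a n
sumFrom-nonneg f a n 0≤f = subst (_≤ sumFrom f a n) (*-zeroʳ (+ n)) (sumFrom-≥ f a n 0≤f)

sumFrom-≥-window : ∀ f a {m k n c} → (∀ i → 0ℤ ≤ f i) → m ℕ.+ k ℕ.≤ n →
  (∀ j → j ℕ.< k → c ≤ f (a + + m + + j)) → + k * c ≤ sumFrom f a n
sumFrom-≥-window f a {m} {k} {c = c} 0≤f m+k≤n c≤f with ℕ.m≤n⇒∃[o]m+o≡n m+k≤n
... | r , refl = begin
  + k * c                                                 ≡⟨ sym (+-identityʳ _) ⟩
  + k * c + 0ℤ                                            ≤⟨ +-mono-≤ (sumFrom-≥ f (a + + m) k c≤f) (nonneg _ r) ⟩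
  sumFrom f (a + + m) k + sumFrom f (a + + m + + k) r     ≡⟨ sym (sumFrom-++ f (a + + m) k r) ⟩
  sumFrom f (a + + m) (k ℕ.+ r)                           ≡⟨ sym (+-identityˡ _) ⟩
  0ℤ + sumFrom f (a + + m) (k ℕ.+ r)                      ≤⟨ +-monoˡ-≤ _ (nonneg a m) ⟩
  sumFrom f a m + sumFrom f (a + + m) (k ℕ.+ r)           ≡⟨ sym (sumFrom-++ f a m (k ℕ.+ r)) ⟩
  sumFrom f a (m ℕ.+ (k ℕ.+ r))                           ≡⟨ cong (sumFrom f a) (sym (ℕ.+-assoc m k r)) ⟩
  sumFrom f a (m ℕ.+ k ℕ.+ r)                             ∎
  where
  open ≤-Reasoning
  nonneg : ∀ b l → 0ℤ ≤ sumFrom f b l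
  nonneg b l = sumFrom-nonneg f b l (λ j _ → 0≤f _)

antitone : ∀ {x : ℤ → ℤ} → (∀ i → x (i + 1ℤ) ≤ x i) → ∀ {i j} → i ≤ j → x j ≤ x i
antitone {x} step {i} {j} i≤j = subst (λ l → x l ≤ x i) i+[j-i]≡j (x[i+k]≤x[i] ∣ j - i ∣)
  where
  x[i+k]≤x[i] : ∀ k → x (i + + k) ≤ x i
  x[i+k]≤x[i] ℕ.zero    = ≤-reflexive (cong x (+-identityʳ i))
  x[i+k]≤x[i] (ℕ.suc k) =
    ≤-trans (subst (λ l → x l ≤ x (i + + k)) i+k+1≡i+[1+k] (step (i + + k))) (x[i+k]≤x[i] k)
    where
    i+k+1≡i+[1+k] : i + + k + 1ℤ ≡ i + + ℕ.suc k
    i+k+1≡i+[1+k] = trans (+-assoc i (+ k) 1ℤ) (cong (λ l → i + + l) (ℕ.+-comm k 1))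
  i+[j-i]≡j : i + + ∣ j - i ∣ ≡ j
  i+[j-i]≡j = trans (cong (λ l → i + l) (0≤i⇒+∣i∣≡i (i≤j⇒0≤j-i i≤j))) (cancel i j)
    where
    cancel : ∀ i j → i + (j - i) ≡ j
    cancel = solve-∀

*-nonneg : ∀ {i j} → 0ℤ ≤ i → 0ℤ ≤ j → 0ℤ ≤ i * j
*-nonneg {j = j} 0≤i 0≤j = *-monoʳ-≤-nonNeg j {{nonNegative 0≤j}} 0≤i

i≤i+j*k : ∀ i {j k} → 0ℤ ≤ j → 0ℤ ≤ k → i ≤ i + j * k
i≤i+j*k i 0≤j 0≤k = i≤i+j i _ {{nonNegative (*-nonneg 0≤j 0≤k)}}

defectˡ : (ℤ → ℤ) → ℕ → ℤ → ℤ → ℤ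
defectˡ x M d s = sumFrom (λ i → (x i - s) * (d - x i)) (- + M) M

defectʳ : (ℤ → ℤ) → ℕ → ℤ → ℤ → ℤ
defectʳ x M d s = sumFrom (λ i → x i * (s + d - x i)) 0ℤ (ℕ.suc M)

q+defects≡2d² : ∀ x M d s → sumSym x M ≡ + M * d →
  q x M d + defectˡ x M d s + defectʳ x M d s ≡ + 2 * d * d
q+defects≡2d² x M d s Σx≡Md = begin
  q x M d + defectˡ x M d s + defectʳ x M d s
    ≡⟨ cong₂ (λ l r → q x M d + l + r) left right ⟩
  sumSym x² M + (+ 2 - + M) * (d * d) + L + ((d + s) * X₂ + -1ℤ * Q₂ + 0ℤ)
    ≡⟨ cong₂ (λ Q X → Q + (+ 2 - + M) * (d * d) + L + ((d + s) * X + -1ℤ * Q₂ + 0ℤ)) (sumSym-split x² M) X₂≡Md-X₁ ⟩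
  Q₁ + Q₂ + (+ 2 - + M) * (d * d) + L + ((d + s) * (+ M * d - X₁) + -1ℤ * Q₂ + 0ℤ)
    ≡⟨ expand (+ M) d s X₁ Q₁ Q₂ ⟩
  + 2 * d * d ∎
  where
  open ≡-Reasoning
  x² : ℤ → ℤ
  x² i = x i * x i
  X₁ X₂ Q₁ Q₂ L : ℤ
  X₁ = sumFrom x (- + M) M
  X₂ = sumFrom x 0ℤ (ℕ.suc M)
  Q₁ = sumFrom x² (- + M) M
  Q₂ = sumFrom x² 0ℤ (ℕ.suc M)
  L  = (d + s) * X₁ + -1ℤ * Q₁ + + M * - (s * d)
  left : defectˡ x M d s ≡ L
  left = trans (sumFrom-cong (λ i → factorˡ (x i) d s) (- + M) M)
               (sumFrom-quadratic x (d + s) -1ℤ (- (s * d)) (- + M) M)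
    where
    factorˡ : ∀ t d s → (t - s) * (d - t) ≡ (d + s) * t + -1ℤ * (t * t) + - (s * d)
    factorˡ = solve-∀
  right : defectʳ x M d s ≡ (d + s) * X₂ + -1ℤ * Q₂ + 0ℤ
  right = trans (sumFrom-cong (λ i → factorʳ (x i) d s) 0ℤ (ℕ.suc M))
          (trans (sumFrom-quadratic x (d + s) -1ℤ 0ℤ 0ℤ (ℕ.suc M))
                 (cong (λ c → (d + s) * X₂ + -1ℤ * Q₂ + c) (*-zeroʳ (+ ℕ.suc M))))
    where
    factorʳ : ∀ t d s → t * (s + d - t) ≡ (d + s) * t + -1ℤ * (t * t) + 0ℤ
    factorʳ = solve-∀
  X₂≡Md-X₁ : X₂ ≡ + M * d - X₁
  X₂≡Md-X₁ = trans (cancel X₁ X₂) (cong (_- X₁) (trans (sym (sumSym-split x M)) Σx≡Md))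
    where
    cancel : ∀ a b → b ≡ a + b - a
    cancel = solve-∀
  expand : ∀ m d s X₁ Q₁ Q₂ →
    Q₁ + Q₂ + (+ 2 - m) * (d * d) + ((d + s) * X₁ + -1ℤ * Q₁ + m * - (s * d))
      + ((d + s) * (m * d - X₁) + -1ℤ * Q₂ + 0ℤ) ≡ + 2 * d * d
  expand = solve-∀

q≤0 : ∀ x M d s → sumSym x M ≡ + M * d →
  + 2 * d * d ≤ defectˡ x M d s + defectʳ x M d s → q x M d ≤ 0ℤ
q≤0 x M d s Σx≡Md 2d²≤defects = ≮⇒≥ λ 0<q → <-irrefl (sym q+defects≡2d²′) (begin-strict
  + 2 * d * d                                     ≡⟨ sym (+-identityˡ _) ⟩
  0ℤ + + 2 * d * d                                <⟨ +-mono-<-≤ 0<q 2d²≤defects ⟩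
  q x M d + (defectˡ x M d s + defectʳ x M d s)   ∎)
  where
  open ≤-Reasoning
  q+defects≡2d²′ : q x M d + (defectˡ x M d s + defectʳ x M d s) ≡ + 2 * d * d
  q+defects≡2d²′ = trans (sym (+-assoc (q x M d) _ _)) (q+defects≡2d² x M d s Σx≡Md)

module Decreasing {x : ℤ → ℤ} {M n : ℕ}
  (zj : IsZJ x M (+ ℕ.suc n)) (x≥0 : ∀ i → 0ℤ ≤ x i) (q>0 : q x M (+ ℕ.suc n) > 0ℤ)
  (x-antitone : ∀ i → x (i + 1ℤ) ≤ x i) where

  d : ℤ
  d = + ℕ.suc n

  2d : ℕ
  2d = 2 ℕ.* ℕ.suc n

  Σx≡Md : sumSym x M ≡ + M * d
  Σx≡Md = proj₁ zj

  x>M≡0 : ∀ i → i > + M → x i ≡ 0ℤ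
  x>M≡0 = proj₁ (proj₂ zj)

  x<-M≡d : ∀ i → i < - + M → x i ≡ d
  x<-M≡d = proj₂ (proj₂ zj)

  q≰0 : ¬ (q x M d ≤ 0ℤ)
  q≰0 = <⇒≱ q>0

  x≤d : ∀ i → x i ≤ d
  x≤d i = ≤-trans (antitone x-antitone (i⊓j≤i i -[1+ M ]))
                  (≤-reflexive (x<-M≡d _ (≤-<-trans (i⊓j≤j i -[1+ M ]) -1-M<-M)))
    where
    -1-M<-M : -[1+ M ] < - + M
    -1-M<-M = neg-mono-< (+<+ (ℕ.n<1+n M))

  x[2d-1]≤0 : x (+ 2 * d - 1ℤ) ≤ 0ℤ
  x[2d-1]≤0 = ≮⇒≥ x[2d-1]≯0
    where
    x[2d-1]≯0 : ¬ (0ℤ < x (+ 2 * d - 1ℤ))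
    x[2d-1]≯0 0<x with 2d ℕ.≤? ℕ.suc M
    ... | no  2d≰1+M = <-irrefl (sym (x>M≡0 _ (+<+ (ℕ.s≤s⁻¹ (ℕ.≰⇒> 2d≰1+M))))) 0<x
    ... | yes 2d≤1+M = q≰0 (q≤0 x M d 1ℤ Σx≡Md (+-mono-≤ left right))
      where
      1≤x : ∀ {i} → i ≤ + 2 * d - 1ℤ → 1ℤ ≤ x i
      1≤x i≤2d-1 = ≤-trans (i<j⇒suc[i]≤j 0<x) (antitone x-antitone i≤2d-1)
      left : 0ℤ ≤ defectˡ x M d 1ℤ
      left = sumFrom-nonneg _ (- + M) M λ j j<M →
        *-nonneg (i≤j⇒0≤j-i (1≤x (≤-trans (negative-index j<M) (+≤+ ℕ.z≤n)))) (i≤j⇒0≤j-i (x≤d _))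
        where
        negative-index : ∀ {j} → j ℕ.< M → - + M + + j ≤ 0ℤ
        negative-index {j} j<M = subst (_≤ 0ℤ) (+-comm (+ j) (- + M)) (i≤j⇒i-j≤0 (+≤+ (ℕ.<⇒≤ j<M)))
      right : + 2d * d ≤ defectʳ x M d 1ℤ
      right = sumFrom-≥-window _ 0ℤ {m = 0} nonneg 2d≤1+M window
        where
        nonneg : ∀ i → 0ℤ ≤ x i * (1ℤ + d - x i)
        nonneg i = *-nonneg (x≥0 i) (i≤j⇒0≤j-i (i≤j⇒i≤1+j (x≤d i)))
        window : ∀ j → j ℕ.< 2d → d ≤ x (+ j) * (1ℤ + d - x (+ j))
        window j j<2d = subst (d ≤_) (sym (expand (x (+ j)) d))
          (i≤i+j*k d (i≤j⇒0≤j-i (1≤x (+≤+ (ℕ.s≤s⁻¹ j<2d)))) (i≤j⇒0≤j-i (x≤d (+ j))))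
          where
          expand : ∀ t d → t * (1ℤ + d - t) ≡ d + (t - 1ℤ) * (d - t)
          expand = solve-∀

  d≤x[-2d] : d ≤ x (- (+ 2 * d))
  d≤x[-2d] = ≮⇒≥ x[-2d]≮d
    where
    x[-2d]≮d : ¬ (x (- (+ 2 * d)) < d)
    x[-2d]≮d x<d with 2d ℕ.≤? M
    ... | no  2d≰M = <-irrefl (x<-M≡d _ (neg-mono-< (+<+ (ℕ.≰⇒> 2d≰M)))) x<d
    ... | yes 2d≤M with ℕ.m≤n⇒∃[o]m+o≡n 2d≤M
    ...   | r , refl = q≰0 (q≤0 x M d -1ℤ Σx≡Md
                           (subst (_≤ defectˡ x M d -1ℤ + defectʳ x M d -1ℤ) (+-identityʳ (+ 2d * d))
                                  (+-mono-≤ left right)))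
      where
      xᵢ<d : ∀ {i} → - (+ 2 * d) ≤ i → x i < d
      xᵢ<d -2d≤i = ≤-<-trans (antitone x-antitone -2d≤i) x<d
      left : + 2d * d ≤ defectˡ x M d -1ℤ
      left = sumFrom-≥-window _ (- + M) {m = r} nonneg (ℕ.≤-reflexive (ℕ.+-comm r 2d)) window
        where
        nonneg : ∀ i → 0ℤ ≤ (x i - -1ℤ) * (d - x i)
        nonneg i = *-nonneg (i≤j⇒0≤j-i (≤-trans -≤+ (x≥0 i))) (i≤j⇒0≤j-i (x≤d i))
        start : - + M + + r ≡ - + 2d
        start = trans (cong (λ m → - m + + r) (pos-+ 2d r)) (cancel (+ 2d) (+ r))
          where
          cancel : ∀ a b → - (a + b) + b ≡ - a
          cancel = solve-∀
        window : ∀ j → j ℕ.< 2d → d ≤ (x (- + M + + r + + j) - -1ℤ) * (d - x (- + M + + r + + j))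
        window j _ = subst (d ≤_) (sym (expand (x i) d))
          (i≤i+j*k d (x≥0 i) (i≤j⇒0≤j-i (i<j⇒i≤pred[j] (xᵢ<d -2d≤i))))
          where
          i : ℤ
          i = - + M + + r + + j
          -2d≤i : - + 2d ≤ i
          -2d≤i = subst (λ a → - + 2d ≤ a + + j) (sym start) (i≤i+j (- + 2d) (+ j))
          expand : ∀ t d → (t - -1ℤ) * (d - t) ≡ d + t * (-1ℤ + d - t)
          expand = solve-∀
      right : 0ℤ ≤ defectʳ x M d -1ℤ
      right = sumFrom-nonneg (λ i → x i * (-1ℤ + d - x i)) 0ℤ (ℕ.suc M) λ j _ →
        *-nonneg (x≥0 _) (i≤j⇒0≤j-i (i<j⇒i≤pred[j] (xᵢ<d -≤+)))

lemma4p1 : (x : ℤ → ℤ) (M : ℕ) (d : ℤ) → IsZJ x M d → d ≥ + 1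
    → (∀ i → + 0 ≤ x i) → q x M d > + 0 → (∀ i → x (i + + 1) ≤ x i)
    → (∀ i → i ≤ - (+ 2 * d) → x i ≡ d) × (∀ i → i ≥ + 2 * d - + 1 → x i ≡ + 0)
lemma4p1 x M (+ ℕ.zero)  zj (+≤+ ()) x≥0 q>0 x-antitone
lemma4p1 x M (+ ℕ.suc n) zj _   x≥0 q>0 x-antitone = x≡d , x≡0
  where
  open Decreasing {x} {M} {n} zj x≥0 q>0 x-antitone
  x≡d : ∀ i → i ≤ - (+ 2 * d) → x i ≡ d
  x≡d i i≤-2d = ≤-antisym (x≤d i) (≤-trans d≤x[-2d] (antitone x-antitone i≤-2d))
  x≡0 : ∀ i → i ≥ + 2 * d - 1ℤ → x i ≡ 0ℤ
  x≡0 i i≥2d-1 = ≤-antisym (≤-trans (antitone x-antitone i≥2d-1) x[2d-1]≤0) (x≥0 i)
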